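{- Let $C$ be a smooth bounded oval in $\mathbb{R}^2$ carrying points $p_1,\ldots,p_k$, numbered consecutively clockwise. Let $p_1'$ be a point of $C$ to the left of $p_1$, infinitesimally close to $p_1$, and let $C_1 = C - \{p_1'\}$, identified (via a distance-preserving homeomorphism $f$) with an open segment $S=(a_1',a_1'')$, where $f(p_i)=a_i$ and the infinitesimally small section $(a_1',a_1)$ is ignored, so that the face set $\mathcal{L}(S)$ consists of the $k$ points and $k$ open sections. For $1<j\le k$, the point $a_j$ splits $S$ into $\{x=a_j\}$, $H_{j,1}=\{x>a_j\}$ and $H_{j,2}=\{x<a_j\}$, which are assigned the signs $0$, $+$, $-$ respectively (or with $+$ and $-$ interchanged); for $j=1$, the point $\{x=a_1\}$ gets $0$ and $H_{1,1}=\{x>a_1\}$ gets $+$ (or $-$). Define $i_H:\mathcal{L}(S)\to(\{+,-,0\})^k$ by letting the $j$-th coordinate of $i_H(P)$ be the sign assigned to the part ($\{x=a_j\}$, $H_{j,1}$ or $H_{j,2}$) containing the face $P$. Then $i_H(\mathcal{L}(S))$ is closed under the componentwise product of $(\{+,-,0\})^k$ (where on $\{+,-,0\}$, $x\cdot y=x$ if $x\neq 0$ and $x\cdot y=y$ otherwise), hence is a left regular band; moreover, different choices of which of $H_{j,1}$, $H_{j,2}$ receives $+$ and which receives $-$ induce isomorphic left regular bands.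
   Context: A left regular band (LRB) is a semigroup satisfying $x\cdot x=x$ and $x\cdot y\cdot x=x\cdot y$. The argument: $C_1$ is topologically equivalent to an open segment, so the situation is that of a pointed line (a special hyperplane arrangement), and flipping the sign convention of some coordinates yields an isomorphic LRB. -}

module Defs where

open import Data.Nat using (ℕ; suc; _*_; _≡ᵇ_; _<ᵇ_)
open import Data.Fin using (Fin; toℕ)
open import Data.Bool using (Bool; true; false; if_then_else_)
open import Data.Vec using (Vec; tabulate; zipWith)
open import Data.Product using (Σ; ∃)
open import Relation.Binary.PropositionalEquality using (_≡_)

data Sign : Set where
  ⊕ ⊖ ⊙ : Sign

infixl 7 _·_
_·_ : Sign → Sign → Sign
⊙ · y = y
x · y = x

infixl 7 _·ᵥ_
_·ᵥ_ : ∀ {k} → Vec Sign k → Vec Sign k → Vec Sign k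
_·ᵥ_ = zipWith _·_

-- Faces of S = (a₁', a₁'') with the section (a₁', a₁) ignored:
-- the k points a_j and the k open sections (a_j, a_{j+1}) (with a_{k+1} := a₁'').
data Face (k : ℕ) : Set where
  point   : Fin k → Face k
  section : Fin k → Face k

-- left-to-right position of a face along S (0-indexed j): a_j ↦ 2j, (a_j,a_{j+1}) ↦ 2j+1
pos : ∀ {k} → Face k → ℕ
pos (point j)   = 2 * toℕ j
pos (section j) = suc (2 * toℕ j)

-- An orientation choice: ε j = true means H_{j,1} = {x > a_j} gets + and
-- H_{j,2} = {x < a_j} gets -; ε j = false means the signs are interchanged.
Orientation : ℕ → Set
Orientation k = Fin k → Bool

sideSign : Bool → Bool → Sign   -- orientation, face lies above a_j
sideSign true  true  = ⊕
sideSign true  false = ⊖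
sideSign false true  = ⊖
sideSign false false = ⊕

coord : ∀ {k} → Orientation k → Face k → Fin k → Sign
coord ε P j =
  if pos P ≡ᵇ (2 * toℕ j) then ⊙
  else sideSign (ε j) ((2 * toℕ j) <ᵇ pos P)

iH : ∀ {k} → Orientation k → Face k → Vec Sign k
iH ε P = tabulate (coord ε P)

Image : ∀ {k} → Orientation k → Set
Image {k} ε = Σ (Vec Sign k) (λ v → ∃ λ (P : Face k) → iH ε P ≡ v)

module Submission where

-- The faces of the pointed line S are encoded by their positions along S:
-- the point a_j sits at the even position 2j and the section (a_j, a_{j+1})
-- at 2j+1, so the hyperplane {x = a_j} is the even position h = 2j.
--
-- Every orientation ε only relabels
--    coordinates by the sign automorphism `orient`, i.e.
--    i_H(P) = twist ε (cov P) with cov P j = σ (2j) (pos P).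
-- 2. Line geometry: composing a point with a face to its right (left) gives
--    the section immediately to its right (left), provided that section is
--    not itself a hyperplane; a section absorbs everything.  Hence the
--    canonical covectors are closed under the product, and so are their
--    twists, since twisting is a homomorphism.
-- 3. {+,-,0}^k is a left regular band, so the image is one as well.
-- 4. Twisting is injective, so a product relation among covectors in one
--    orientation holds in every other; relabelling i_ε(P) ↦ i_ε'(P) is
--    therefore a bijective homomorphism between the images.

open import Defs
open import Data.Nat using (ℕ; suc; _*_; _≡ᵇ_; _<ᵇ_; _<_; s≤s)
open import Data.Nat.Properties
  using (_≟_; _<?_; <-cmp; <-trans; n<1+n; ≤∧≢⇒<; <⇒≢; >⇒≢; even≢odd; *-suc)
open import Data.Fin using (Fin; toℕ; inject₁) renaming (zero to fzero; suc to fsuc)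
open import Data.Fin.Properties using (toℕ-inject₁)
open import Data.Bool using (Bool; true; false; if_then_else_)
open import Data.Empty using (⊥-elim)
open import Data.Vec using (Vec; []; _∷_; tabulate; zipWith; lookup)
open import Data.Vec.Properties using (zipWith-idem; tabulate-cong; lookup∘tabulate)
open import Data.Product using (Σ; ∃; _×_; _,_; proj₁; proj₂)
open import Function.Bundles using (_⤖_; Bijection; mk⤖)
open import Relation.Binary using (tri<; tri≈; tri>)
open import Relation.Binary.PropositionalEquality
  using (_≡_; _≢_; refl; sym; trans; cong; cong₂; subst; module ≡-Reasoning)
open import Relation.Nullary.Decidable using (dec-true; dec-false)

open ≡-Reasoning

·-idem : ∀ x → x · x ≡ x
·-idem ⊕ = refl
·-idem ⊖ = refl
·-idem ⊙ = refl

·-leftRegular : ∀ x y → x · y · x ≡ x · y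
·-leftRegular ⊕ y = refl
·-leftRegular ⊖ y = refl
·-leftRegular ⊙ ⊕ = refl
·-leftRegular ⊙ ⊖ = refl
·-leftRegular ⊙ ⊙ = refl

·ᵥ-idem : ∀ {k} (u : Vec Sign k) → u ·ᵥ u ≡ u
·ᵥ-idem = zipWith-idem ·-idem

·ᵥ-leftRegular : ∀ {k} (u v : Vec Sign k) → u ·ᵥ v ·ᵥ u ≡ u ·ᵥ v
·ᵥ-leftRegular []      []      = refl
·ᵥ-leftRegular (x ∷ u) (y ∷ v) = cong₂ _∷_ (·-leftRegular x y) (·ᵥ-leftRegular u v)

zipWith-tabulate : ∀ {k} {A : Set} (f : A → A → A) (g h : Fin k → A) →
  zipWith f (tabulate g) (tabulate h) ≡ tabulate (λ j → f (g j) (h j))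
zipWith-tabulate {0}     f g h = refl
zipWith-tabulate {suc k} f g h =
  cong (f (g fzero) (h fzero) ∷_) (zipWith-tabulate f (λ j → g (fsuc j)) (λ j → h (fsuc j)))

orient : Bool → Sign → Sign
orient true  x = x
orient false ⊕ = ⊖
orient false ⊖ = ⊕
orient false ⊙ = ⊙

orient-hom : ∀ e x y → orient e (x · y) ≡ orient e x · orient e y
orient-hom true  x y = refl
orient-hom false ⊕ y = refl
orient-hom false ⊖ y = refl
orient-hom false ⊙ y = refl

orient-involutive : ∀ e x → orient e (orient e x) ≡ x
orient-involutive true  x = refl
orient-involutive false ⊕ = refl
orient-involutive false ⊖ = refl
orient-involutive false ⊙ = refl

orient-zero : ∀ e → orient e ⊙ ≡ ⊙
orient-zero true  = refl
orient-zero false = refl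

orient-sideSign : ∀ e b → orient e (sideSign true b) ≡ sideSign e b
orient-sideSign true  b     = refl
orient-sideSign false true  = refl
orient-sideSign false false = refl

σ : ℕ → ℕ → Sign
σ h p = if p ≡ᵇ h then ⊙ else sideSign true (h <ᵇ p)

-- The three values of σ, according to how p compares with h; the boolean
-- tests in σ are by definition the decisions `does (p ≟ h)`, `does (h <? p)`.
σ-at : ∀ h → σ h h ≡ ⊙
σ-at h rewrite dec-true (h ≟ h) refl = refl

σ-above : ∀ {h p} → h < p → σ h p ≡ ⊕
σ-above {h} {p} h<p rewrite dec-false (p ≟ h) (>⇒≢ h<p) | dec-true (h <? p) h<p = refl

σ-below : ∀ {h p} → p < h → σ h p ≡ ⊖
σ-below {h} {p} p<h
  rewrite dec-false (p ≟ h) (<⇒≢ p<h) | dec-false (h <? p) (λ h<p → <⇒≢ (<-trans p<h h<p) refl)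
  = refl

σ-absorbs : ∀ {h p} → h ≢ p → ∀ y → σ h p · y ≡ σ h p
σ-absorbs {h} {p} h≢p y with <-cmp h p
... | tri< h<p _ _ rewrite σ-above h<p = refl
... | tri≈ _ h≡p _ = ⊥-elim (h≢p h≡p)
... | tri> _ _ p<h rewrite σ-below p<h = refl

-- A face p composed with a face q to its right is the face just right of p,
-- as long as that face is not the hyperplane h itself.
σ-toward-right : ∀ {h p q} → p < q → h ≢ suc p → σ h p · σ h q ≡ σ h (suc p)
σ-toward-right {h} {p} {q} p<q h≢1+p with <-cmp h p
... | tri< h<p _ _ rewrite σ-above h<p | σ-above (<-trans h<p (n<1+n p)) = refl
... | tri≈ _ refl _ rewrite σ-at h | σ-above p<q | σ-above (n<1+n h) = refl
... | tri> _ _ p<h rewrite σ-below p<h | σ-below (≤∧≢⇒< p<h (λ e → h≢1+p (sym e))) = refl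

-- Symmetrically, a face composed with a face to its left moves one step left.
σ-toward-left : ∀ {h p q} → q < suc p → h ≢ p → σ h (suc p) · σ h q ≡ σ h p
σ-toward-left {h} {p} {q} q<1+p h≢p with <-cmp h (suc p)
... | tri< (s≤s h≤p) _ _ rewrite σ-above (s≤s h≤p) | σ-above (≤∧≢⇒< h≤p h≢p) = refl
... | tri≈ _ refl _ rewrite σ-at (suc p) | σ-below q<1+p | σ-below (n<1+n p) = refl
... | tri> _ _ 1+p<h rewrite σ-below 1+p<h | σ-below (<-trans (n<1+n p) 1+p<h) = refl

cov : ∀ {k} → Face k → Fin k → Sign
cov P j = σ (2 * toℕ j) (pos P)

twist : ∀ {k} → Orientation k → (Fin k → Sign) → Vec Sign k
twist ε u = tabulate (λ j → orient (ε j) (u j))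

iH-twist : ∀ {k} (ε : Orientation k) (P : Face k) → iH ε P ≡ twist ε (cov P)
iH-twist ε P = tabulate-cong λ j → sym (orient-σ (ε j) (2 * toℕ j) (pos P))
  where
  orient-σ : ∀ e h p →
    orient e (σ h p) ≡ (if p ≡ᵇ h then ⊙ else sideSign e (h <ᵇ p))
  orient-σ e h p with p ≡ᵇ h | h <ᵇ p
  ... | true  | _ = orient-zero e
  ... | false | b = orient-sideSign e b

iH-product : ∀ {k} (ε : Orientation k) (P Q : Face k) →
  iH ε P ·ᵥ iH ε Q ≡ twist ε (λ j → cov P j · cov Q j)
iH-product ε P Q = begin
  iH ε P ·ᵥ iH ε Q
    ≡⟨ cong₂ _·ᵥ_ (iH-twist ε P) (iH-twist ε Q) ⟩
  twist ε (cov P) ·ᵥ twist ε (cov Q)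
    ≡⟨ zipWith-tabulate _·_ _ _ ⟩
  tabulate (λ j → orient (ε j) (cov P j) · orient (ε j) (cov Q j))
    ≡⟨ tabulate-cong (λ j → sym (orient-hom (ε j) (cov P j) (cov Q j))) ⟩
  twist ε (λ j → cov P j · cov Q j)
    ∎

-- Twisting respects pointwise equality and, since each `orient e` is an
-- involution, also reflects it.
twist-cong : ∀ {k} (ε : Orientation k) {u v : Fin k → Sign} →
  (∀ j → u j ≡ v j) → twist ε u ≡ twist ε v
twist-cong ε u≗v = tabulate-cong (λ j → cong (orient (ε j)) (u≗v j))

twist-injective : ∀ {k} (ε : Orientation k) {u v : Fin k → Sign} →
  twist ε u ≡ twist ε v → ∀ j → u j ≡ v j
twist-injective ε {u} {v} eq j = begin
  u j                                  ≡⟨ sym (orient-involutive (ε j) (u j)) ⟩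
  orient (ε j) (orient (ε j) (u j))    ≡⟨ cong (orient (ε j)) (sym (lookup∘tabulate _ j)) ⟩
  orient (ε j) (lookup (twist ε u) j)  ≡⟨ cong (λ w → orient (ε j) (lookup w j)) eq ⟩
  orient (ε j) (lookup (twist ε v) j)  ≡⟨ cong (orient (ε j)) (lookup∘tabulate _ j) ⟩
  orient (ε j) (orient (ε j) (v j))    ≡⟨ orient-involutive (ε j) (v j) ⟩
  v j                                  ∎

-- The section left of the point a_{i+1} is (a_i, a_{i+1}).
section-left-of : ∀ {k} (i : Fin k) →
  suc (pos (section {suc k} (inject₁ i))) ≡ pos (point {suc k} (fsuc i))
section-left-of i = begin
  suc (suc (2 * toℕ (inject₁ i)))  ≡⟨ cong (λ n → suc (suc (2 * n))) (toℕ-inject₁ i) ⟩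
  suc (suc (2 * toℕ i))            ≡⟨ sym (*-suc 2 (toℕ i)) ⟩
  2 * suc (toℕ i)                  ∎

-- The face P·Q: P if P is a section or Q = P, otherwise the section next to
-- the point P on the side of Q.
cov-product : ∀ {k} (P Q : Face k) → ∃ λ (R : Face k) → ∀ j → cov P j · cov Q j ≡ cov R j
cov-product (section i) Q =
  section i , λ j → σ-absorbs (even≢odd (toℕ j) (toℕ i)) (cov Q j)
cov-product (point i) Q with <-cmp (pos Q) (2 * toℕ i)
... | tri≈ _ same _ = point i , λ j →
  subst (λ q → cov (point i) j · σ (2 * toℕ j) q ≡ cov (point i) j) (sym same)
    (·-idem (cov (point i) j))
... | tri> _ _ right =
  section i , λ j → σ-toward-right right (even≢odd (toℕ j) (toℕ i))
cov-product {suc k} (point (fsuc i)) Q | tri< left _ _ =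
  section (inject₁ i) , λ j →
    subst (λ p → σ (2 * toℕ j) p · cov Q j ≡ cov (section (inject₁ i)) j)
      (section-left-of i)
      (σ-toward-left (subst (pos Q <_) (sym (section-left-of i)) left)
                     (even≢odd (toℕ j) (toℕ (inject₁ i))))

iH-closed : ∀ {k} (ε : Orientation k) (P Q : Face k) →
  ∃ λ (R : Face k) → iH ε P ·ᵥ iH ε Q ≡ iH ε R
iH-closed ε P Q with cov-product P Q
... | R , PQ≗R = R , (begin
  iH ε P ·ᵥ iH ε Q                    ≡⟨ iH-product ε P Q ⟩
  twist ε (λ j → cov P j · cov Q j)   ≡⟨ twist-cong ε PQ≗R ⟩
  twist ε (cov R)                     ≡⟨ iH-twist ε R ⟨
  iH ε R                              ∎)

iH-reorient : ∀ {k} (ε ε' : Orientation k) (P Q R : Face k) →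
  iH ε R ≡ iH ε P ·ᵥ iH ε Q → iH ε' R ≡ iH ε' P ·ᵥ iH ε' Q
iH-reorient ε ε' P Q R eq = begin
  iH ε' R                             ≡⟨ iH-twist ε' R ⟩
  twist ε' (cov R)                    ≡⟨ twist-cong ε' R≗PQ ⟩
  twist ε' (λ j → cov P j · cov Q j)  ≡⟨ iH-product ε' P Q ⟨
  iH ε' P ·ᵥ iH ε' Q                  ∎
  where
  R≗PQ : ∀ j → cov R j ≡ cov P j · cov Q j
  R≗PQ = twist-injective ε (trans (sym (iH-twist ε R)) (trans eq (iH-product ε P Q)))

relabel : ∀ {k} (ε ε' : Orientation k) → Image ε → Image ε'
relabel ε ε' (_ , P , _) = iH ε' P , P , refl

relabel-injective : ∀ {k} (ε ε' : Orientation k) {x y : Image ε} →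
  relabel ε ε' x ≡ relabel ε ε' y → x ≡ y
relabel-injective ε ε' {_ , P , refl} {_ , Q , refl} eq
  with cong (λ z → proj₁ (proj₂ z)) eq
... | refl = refl

relabel-surjective : ∀ {k} (ε ε' : Orientation k) (y : Image ε') →
  ∃ λ (x : Image ε) → ∀ {z} → z ≡ x → relabel ε ε' z ≡ y
relabel-surjective ε ε' (_ , P , refl) = (iH ε P , P , refl) , λ { refl → refl }

relabelling : ∀ {k} (ε ε' : Orientation k) → Image ε ⤖ Image ε'
relabelling ε ε' = mk⤖ (relabel-injective ε ε' , relabel-surjective ε ε')

relabel-hom : ∀ {k} (ε ε' : Orientation k) (x y z : Image ε) →
  proj₁ z ≡ proj₁ x ·ᵥ proj₁ y →
  proj₁ (relabel ε ε' z) ≡ proj₁ (relabel ε ε' x) ·ᵥ proj₁ (relabel ε ε' y)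
relabel-hom ε ε' (_ , P , refl) (_ , Q , refl) (_ , R , refl) = iH-reorient ε ε' P Q R


mainTheorem4 : (k : ℕ) →
    ((ε : Orientation k) → (P Q : Face k) → ∃ λ (R : Face k) → iH ε P ·ᵥ iH ε Q ≡ iH ε R)
    × ((ε : Orientation k) → (x y : Image ε) →
         (proj₁ x ·ᵥ proj₁ x ≡ proj₁ x)
         × (proj₁ x ·ᵥ proj₁ y ·ᵥ proj₁ x ≡ proj₁ x ·ᵥ proj₁ y))
    × ((ε ε' : Orientation k) → Σ (Image ε ⤖ Image ε') λ φ →
         (x y z : Image ε) → proj₁ z ≡ proj₁ x ·ᵥ proj₁ y →
           proj₁ (Bijection.to φ z) ≡ proj₁ (Bijection.to φ x) ·ᵥ proj₁ (Bijection.to φ y))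
mainTheorem4 k =
  iH-closed ,
  (λ ε x y → ·ᵥ-idem (proj₁ x) , ·ᵥ-leftRegular (proj₁ x) (proj₁ y)) ,
  (λ ε ε' → relabelling ε ε' , relabel-hom ε ε')
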